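{- Let $T$ be a skeleton. For every brrb-path $P$ in $T$, there is a building sequence of $T$ whose first path is $P$.
   Context: A $k$-path is a path with $k$ edges. Skeleton: a tree $T$ is a skeleton if there exist a coloring $\lambda:V(T)\to\{\text{black},\text{red}\}$, trees $T_0,\dots,T_t$ ($t\ge 0$) and paths $P_1,\dots,P_t$ such that: $T_0=x_0x_1x_2x_3$ is a $3$-path with $x_0,x_3$ black and $x_1,x_2$ red; $T_t=T$; each $P_i=x_0x_1\cdots x_k$ has $k\in\{4,6\}$, and $T_i$ is obtained from $T_{i-1}$ by adding $P_i$ so that its middle vertex $x_{k/2}$ (the joint of $P_i$) is identified with a vertex of $T_{i-1}$ (and $P_i$ is otherwise disjoint from $T_{i-1}$); in $P_i$ the vertices $x_0,x_k$ are black, $x_1,x_{k-1}$ are red, if $k=4$ then $x_2$ is red, and if $k=6$ then $x_3$ is black and $x_2,x_4$ are red. Such a coloring is unique (black vertices are exactly the odd-degree vertices, red ones the even-degree vertices). The sequence $P_0:=T_0,P_1,\dots,P_t$ is called a building sequence of $T$. A brrb-path of $T$ is a $3$-path $y_0y_1y_2y_3$ in $T$ with $y_0,y_3$ black and $y_1,y_2$ red. -}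

module Defs where

open import Data.Nat using (ℕ)
import Data.Empty
import Data.Unit
open import Data.Fin using (Fin)
open import Data.List using (List; []; _∷_; _++_; map; reverse; concat)
open import Data.List.Membership.Propositional using (_∈_; _∉_)
open import Data.List.Relation.Unary.Unique.Propositional using (Unique)
open import Data.List.Relation.Unary.Linked using (Linked)
open import Data.Product using (Σ; _×_; ∃; ∃-syntax)
open import Data.Sum using (_⊎_)
open import Function.Bundles using (_⇔_)
open import Relation.Binary.PropositionalEquality using (_≡_)

data Colour : Set where
  black red : Colour

record Graph (n : ℕ) : Set₁ where
  field
    Adj  : Fin n → Fin n → Set
    sym  : ∀ {u v} → Adj u v → Adj v u
    irr  : ∀ {u} → Adj u u → Data.Empty.⊥
open Graph public
  hiding (sym; irr)

module _ {n : ℕ} where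

  IsPath : Graph n → List (Fin n) → Set
  IsPath G xs = Unique xs × Linked (Adj G) xs

  data Step : List (Fin n) → Fin n → Fin n → Set where
    here  : ∀ {u v xs} → Step (u ∷ v ∷ xs) u v
    there : ∀ {x u v xs} → Step xs u v → Step (x ∷ xs) u v

  PathEdge : List (Fin n) → Fin n → Fin n → Set
  PathEdge xs u v = Step xs u v ⊎ Step xs v u

  -- Shape and colour pattern of an added path P_i (k = 4 or k = 6),
  -- together with its joint (middle vertex).
  data Joint : List (Fin n) → Fin n → List Colour → Set where
    k4 : ∀ {a b c d e} →
         Joint (a ∷ b ∷ c ∷ d ∷ e ∷ []) c
               (black ∷ red ∷ red ∷ red ∷ black ∷ [])
    k6 : ∀ {a b c d e f g} →
         Joint (a ∷ b ∷ c ∷ d ∷ e ∷ f ∷ g ∷ []) d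
               (black ∷ red ∷ red ∷ black ∷ red ∷ red ∷ black ∷ [])

  ValidAdditions : (Fin n → Colour) → List (Fin n) → List (List (Fin n)) → Set
  ValidAdditions λc prev [] = Data.Unit.⊤
  ValidAdditions λc prev (P ∷ Ps) =
    (Σ (Fin n) λ j → Σ (List Colour) λ cs →
        Joint P j cs × map λc P ≡ cs × j ∈ prev ×
        (∀ {x} → x ∈ P → x ∈ prev → x ≡ j))
    × Unique P
    × ValidAdditions λc (prev ++ P) Ps

  record BuildingSequence (G : Graph n) (λc : Fin n → Colour) : Set where
    field
      first : List (Fin n)
      rest  : List (List (Fin n))
      first-path   : IsPath G first
      first-colour : map λc first ≡ black ∷ red ∷ red ∷ black ∷ []
      additions    : ValidAdditions λc first rest
      -- T_t = G : same vertices and same edges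
      covers-vertices : ∀ (v : Fin n) → v ∈ concat (first ∷ rest)
      same-edges : ∀ (u v : Fin n) →
        Adj G u v ⇔ (∃[ P ] (P ∈ (first ∷ rest) × PathEdge P u v))
  open BuildingSequence public

  IsSkeleton : Graph n → (Fin n → Colour) → Set
  IsSkeleton G λc = BuildingSequence G λc

  IsBrrbPath : Graph n → (Fin n → Colour) → List (Fin n) → Set
  IsBrrbPath G λc ys = IsPath G ys × map λc ys ≡ black ∷ red ∷ red ∷ black ∷ []

module Submission where

-- A tree is represented by the list of paths it is drawn from, and such lists are compared
-- only through the graph they draw (_≋_: same vertices, same edges).  The given building
-- sequence is replayed as a `Built` tree, newest path first, and `reroot` shows by induction
-- on it that every brrb-path ys of a built tree starts a valid sequence drawing the same graph.
-- If the middle edge of ys is old, ys lies in the older tree: restart there and attach the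
-- newest path Pt at the end (`rebuilt-extend`).  Otherwise ys runs from an end of Pt into its
-- joint; we extend the old part of ys to a brrb-path O of the older tree, restart at O by
-- induction, and regroup Pt and O into ys followed by one new path of the required shape
-- through the joint (`splice4`, `splice6`, `reroute`).

open import Defs
open import Data.Nat using (ℕ)
open import Data.Fin using (Fin)
open import Data.List using (List; []; _∷_; _++_; map; reverse; reverseAcc; concat)
open import Data.List.Properties using (reverse-involutive; ++-identityʳ; ++-assoc)
open import Data.List.Membership.Propositional using (_∈_; find)
open import Data.List.Membership.Propositional.Properties
  using (∈-++⁺ˡ; ∈-++⁺ʳ; ∈-++⁻; ∈-concat⁺; ∈-concat⁻; ∃∈-Any)
open import Data.List.Relation.Binary.Permutation.Propositional using (_↭_; ↭-sym)
open import Data.List.Relation.Binary.Permutation.Propositional.Properties using (Any-resp-↭; shift; ++-comm)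
open import Data.List.Relation.Binary.Pointwise using (Pointwise; []; _∷_)
open import Data.List.Relation.Unary.Any as Any using (Any; here; there)
import Data.List.Relation.Unary.Any.Properties as Anyₚ
open import Data.List.Relation.Unary.All as All using (All; []; _∷_)
open import Data.List.Relation.Unary.AllPairs using ([]; _∷_)
open import Data.List.Relation.Unary.Linked as Linked using (Linked; []; [-]; _∷_)
open import Data.List.Relation.Unary.Unique.Propositional using (Unique)
open import Data.Product as Product using (Σ; _×_; _,_; proj₁; proj₂)
open import Data.Sum as Sum using (_⊎_; inj₁; inj₂; [_,_]′)
open import Data.Unit using (tt)
open import Data.Empty using (⊥; ⊥-elim)
open import Function using (_∘_)
open import Function.Bundles using (mk⇔; Equivalence)
open import Relation.Binary.PropositionalEquality using (_≡_; _≢_; refl; sym; trans; cong; subst; ≢-sym)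

module Rerooting {n : ℕ} (λc : Fin n → Colour) where

  V : Set
  V = Fin n

  Black Red : V → Set
  Black x = λc x ≡ black
  Red   x = λc x ≡ red

  clash : ∀ {x} → Black x → Red x → ⊥
  clash bx rx with trans (sym bx) rx
  ... | ()

  black≢red : ∀ {x y} → Black x → Red y → x ≢ y
  black≢red bx ry refl = clash bx ry

  red≢black : ∀ {x y} → Red x → Black y → x ≢ y
  red≢black rx by = ≢-sym (black≢red by rx)

  Coloured : List V → List Colour → Set
  Coloured = Pointwise (λ x c → λc x ≡ c)

  coloured : ∀ xs {cs} → map λc xs ≡ cs → Coloured xs cs
  coloured []       refl = []
  coloured (x ∷ xs) refl = refl ∷ coloured xs refl

  uncoloured : ∀ {xs cs} → Coloured xs cs → map λc xs ≡ cs
  uncoloured []           = refl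
  uncoloured (refl ∷ cxs) = cong (_ ∷_) (uncoloured cxs)

  brrb : List Colour
  brrb = black ∷ red ∷ red ∷ black ∷ []

  step-ends : ∀ {xs : List V} {u v} → Step xs u v → u ∈ xs × v ∈ xs
  step-ends here      = here refl , there (here refl)
  step-ends (there s) = Product.map there there (step-ends s)

  pathEdge-ends : ∀ {xs : List V} {u v} → PathEdge xs u v → u ∈ xs × v ∈ xs
  pathEdge-ends (inj₁ s) = step-ends s
  pathEdge-ends (inj₂ s) = Product.swap (step-ends s)

  pathEdge-sym : ∀ {xs : List V} {u v} → PathEdge xs u v → PathEdge xs v u
  pathEdge-sym = Sum.swap

  linked-step : ∀ {R : V → V → Set} {xs : List V} {u v} → Linked R xs → Step xs u v → R u v
  linked-step (r ∷ _)  here      = r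
  linked-step (_ ∷ rs) (there s) = linked-step rs s
  linked-step [-]      (there ())

  linked : ∀ {R : V → V → Set} xs → (∀ {u v} → Step xs u v → R u v) → Linked R xs
  linked []           _ = []
  linked (_ ∷ [])     _ = [-]
  linked (x ∷ y ∷ xs) r = r here ∷ linked (y ∷ xs) (λ s → r (there s))

  step-reverseAcc-keep : ∀ (acc xs : List V) {u v} → Step acc u v → Step (reverseAcc acc xs) u v
  step-reverseAcc-keep acc []       s = s
  step-reverseAcc-keep acc (x ∷ xs) s = step-reverseAcc-keep (x ∷ acc) xs (there s)

  step-reverseAcc-flip : ∀ (acc xs : List V) {u v} → Step xs u v → Step (reverseAcc acc xs) v u
  step-reverseAcc-flip acc (u ∷ v ∷ xs) here      = step-reverseAcc-keep (v ∷ u ∷ acc) xs here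
  step-reverseAcc-flip acc (x ∷ xs)     (there s) = step-reverseAcc-flip (x ∷ acc) xs s

  pathEdge-reverse : ∀ (xs : List V) {u v} → PathEdge xs u v → PathEdge (reverse xs) u v
  pathEdge-reverse xs (inj₁ s) = inj₂ (step-reverseAcc-flip [] xs s)
  pathEdge-reverse xs (inj₂ s) = inj₁ (step-reverseAcc-flip [] xs s)

  pathEdge-unreverse : ∀ (xs : List V) {u v} → PathEdge (reverse xs) u v → PathEdge xs u v
  pathEdge-unreverse xs e =
    subst (λ ys → PathEdge ys _ _) (reverse-involutive xs) (pathEdge-reverse (reverse xs) e)

  -- A tree is given by the list of paths it is drawn from; Vert and Edge are its vertices and edges.
  Paths : Set
  Paths = List (List V)

  Vert : Paths → V → Set
  Vert Ps x = Any (x ∈_) Ps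

  Edge : Paths → V → V → Set
  Edge Ps u v = Any (λ P → PathEdge P u v) Ps

  edge-sym : ∀ {Ps u v} → Edge Ps u v → Edge Ps v u
  edge-sym = Any.map pathEdge-sym

  edge-ends : ∀ {Ps u v} → Edge Ps u v → Vert Ps u × Vert Ps v
  edge-ends e = Any.map (λ pe → proj₁ (pathEdge-ends pe)) e , Any.map (λ pe → proj₂ (pathEdge-ends pe)) e

  fwd : ∀ {P Ps u v} → Step P u v → Edge (P ∷ Ps) u v
  fwd s = here (inj₁ s)

  bwd : ∀ {P Ps u v} → Step P v u → Edge (P ∷ Ps) u v
  bwd s = here (inj₂ s)

  record _⊑_ (Ps Qs : Paths) : Set where
    field
      vert : ∀ {x} → Vert Ps x → Vert Qs x
      edge : ∀ {u v} → Edge Ps u v → Edge Qs u v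
  open _⊑_

  _≋_ : Paths → Paths → Set
  Ps ≋ Qs = Ps ⊑ Qs × Qs ⊑ Ps

  ⊑-refl : ∀ {Ps} → Ps ⊑ Ps
  ⊑-refl = record { vert = λ x → x ; edge = λ e → e }

  ⊑-trans : ∀ {Ps Qs Rs} → Ps ⊑ Qs → Qs ⊑ Rs → Ps ⊑ Rs
  ⊑-trans p q = record { vert = vert q ∘ vert p ; edge = edge q ∘ edge p }

  ≋-refl : ∀ {Ps} → Ps ≋ Ps
  ≋-refl = ⊑-refl , ⊑-refl

  ≋-sym : ∀ {Ps Qs} → Ps ≋ Qs → Qs ≋ Ps
  ≋-sym (p , q) = q , p

  ≋-trans : ∀ {Ps Qs Rs} → Ps ≋ Qs → Qs ≋ Rs → Ps ≋ Rs
  ≋-trans (p , p') (q , q') = ⊑-trans p q , ⊑-trans q' p'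

  ↭⇒≋ : ∀ {Ps Qs} → Ps ↭ Qs → Ps ≋ Qs
  ↭⇒≋ σ = along σ , along (↭-sym σ)
    where
      along : ∀ {Ps Qs} → Ps ↭ Qs → Ps ⊑ Qs
      along σ = record { vert = Any-resp-↭ σ ; edge = Any-resp-↭ σ }

  ++-mono-⊑ : ∀ {Ps Ps' Qs Qs'} → Ps ⊑ Ps' → Qs ⊑ Qs' → (Ps ++ Qs) ⊑ (Ps' ++ Qs')
  ++-mono-⊑ {Ps} {Ps'} p q = record
    { vert = [ Anyₚ.++⁺ˡ ∘ vert p , Anyₚ.++⁺ʳ Ps' ∘ vert q ]′ ∘ Anyₚ.++⁻ Ps
    ; edge = [ Anyₚ.++⁺ˡ ∘ edge p , Anyₚ.++⁺ʳ Ps' ∘ edge q ]′ ∘ Anyₚ.++⁻ Ps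
    }

  ++-cong-≋ : ∀ {Ps Ps' Qs Qs'} → Ps ≋ Ps' → Qs ≋ Qs' → (Ps ++ Qs) ≋ (Ps' ++ Qs')
  ++-cong-≋ (p , p') (q , q') = ++-mono-⊑ p q , ++-mono-⊑ p' q'

  reverse-≋ : ∀ (P : List V) → (reverse P ∷ []) ≋ (P ∷ [])
  reverse-≋ P = single (pathEdge-unreverse P) Anyₚ.reverse⁻ , single (pathEdge-reverse P) Anyₚ.reverse⁺
    where
      single : ∀ {P Q : List V} → (∀ {u v} → PathEdge P u v → PathEdge Q u v) → (∀ {x} → x ∈ P → x ∈ Q) →
               (P ∷ []) ⊑ (Q ∷ [])
      single e v = record { vert = λ { (here x∈P) → here (v x∈P) ; (there ()) }
                          ; edge = λ { (here pe) → here (e pe) ; (there ()) } }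

  mirrored : ∀ (P : List V) {Ps} → (reverse P ∷ Ps) ≋ (P ∷ Ps)
  mirrored P = ++-cong-≋ (reverse-≋ P) ≋-refl

  Drawn : Paths → List V → Set
  Drawn Qs P = All (Vert Qs) P × Linked (Edge Qs) P

  walk : ∀ {Qs x y xs} → Linked (Edge Qs) (x ∷ y ∷ xs) → Drawn Qs (x ∷ y ∷ xs)
  walk l = ends l , l
    where
      ends : ∀ {Qs x y xs} → Linked (Edge Qs) (x ∷ y ∷ xs) → All (Vert Qs) (x ∷ y ∷ xs)
      ends (e ∷ [-])       = proj₁ (edge-ends e) ∷ proj₂ (edge-ends e) ∷ []
      ends (e ∷ l@(_ ∷ _)) = proj₁ (edge-ends e) ∷ ends l

  drawn⇒⊑ : ∀ {Ps Qs} → All (Drawn Qs) Ps → Ps ⊑ Qs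
  drawn⇒⊑ ds = record { vert = vertices ds ; edge = edges ds }
    where
      vertices : ∀ {Ps Qs x} → All (Drawn Qs) Ps → Vert Ps x → Vert Qs x
      vertices ((vs , _) ∷ _) (here x∈P) = All.lookup vs x∈P
      vertices (_ ∷ ds)       (there x)  = vertices ds x

      edges : ∀ {Ps Qs u v} → All (Drawn Qs) Ps → Edge Ps u v → Edge Qs u v
      edges ((_ , es) ∷ _) (here (inj₁ s)) = linked-step es s
      edges ((_ , es) ∷ _) (here (inj₂ s)) = edge-sym (linked-step es s)
      edges (_ ∷ ds)       (there e)       = edges ds e

  Brrb : (V → V → Set) → List V → Set
  Brrb E ys = Unique ys × Linked E ys × Coloured ys brrb

  -- Colours make most vertices of a brrb-path distinct; the ends and the middle pair must be checked.
  brrb-path : ∀ {E : V → V → Set} {y0 y1 y2 y3} → Black y0 → Red y1 → Red y2 → Black y3 →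
              y0 ≢ y3 → y1 ≢ y2 → E y0 y1 → E y1 y2 → E y2 y3 → Brrb E (y0 ∷ y1 ∷ y2 ∷ y3 ∷ [])
  brrb-path c0 c1 c2 c3 y0≢y3 y1≢y2 e01 e12 e23 =
    ( (black≢red c0 c1 ∷ black≢red c0 c2 ∷ y0≢y3 ∷ []) ∷ (y1≢y2 ∷ red≢black c1 c3 ∷ []) ∷
      (red≢black c2 c3 ∷ []) ∷ [] ∷ [] )
    , e01 ∷ e12 ∷ e23 ∷ [-] , c0 ∷ c1 ∷ c2 ∷ c3 ∷ []

  record Attached (M : V → Set) (P : List V) : Set where
    constructor attached
    field
      joint    : V
      palette  : List Colour
      shape    : Joint P joint palette
      colours  : Coloured P palette
      distinct : Unique P
      anchored : M joint
      only     : ∀ {x} → x ∈ P → M x → x ≡ joint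

  attached-resp : ∀ {M M' : V → Set} {P} → (∀ {x} → M x → M' x) → (∀ {x} → x ∈ P → M' x → M x) →
                  Attached M P → Attached M' P
  attached-resp to from (attached j cs sh col U jm only) =
    attached j cs sh col U (to jm) (λ x∈P m → only x∈P (from x∈P m))

  Valid : List V → Paths → Set
  Valid = ValidAdditions λc

  attach-step : ∀ {prev P R} → Attached (_∈ prev) P → Valid (prev ++ P) R → Valid prev (P ∷ R)
  attach-step (attached j cs sh col U jm only) va = (j , cs , sh , uncoloured col , jm , only) , U , va

  first-attached : ∀ {prev P R} → Valid prev (P ∷ R) → Attached (_∈ prev) P
  first-attached ((j , cs , sh , m , jm , only) , U , _) = attached j cs sh (coloured _ m) U jm only

  valid-resp : ∀ {prev prev'} R → (∀ {x} → x ∈ prev → x ∈ prev') →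
               (∀ {x} → x ∈ prev' → x ∈ concat R → x ∈ prev) → Valid prev R → Valid prev' R
  valid-resp [] _ _ _ = tt
  valid-resp {prev} {prev'} (P ∷ R) to from va@(_ , _ , rest) =
    attach-step (attached-resp to (λ x∈P x∈prev' → from x∈prev' (∈-++⁺ˡ x∈P)) (first-attached va))
                (valid-resp R to' from' rest)
    where
      to' : ∀ {x} → x ∈ prev ++ P → x ∈ prev' ++ P
      to' = [ ∈-++⁺ˡ ∘ to , ∈-++⁺ʳ prev' ]′ ∘ ∈-++⁻ prev

      from' : ∀ {x} → x ∈ prev' ++ P → x ∈ concat R → x ∈ prev ++ P
      from' x∈ x∈R = [ (λ x∈prev' → ∈-++⁺ˡ (from x∈prev' (∈-++⁺ʳ P x∈R))) , ∈-++⁺ʳ prev ]′ (∈-++⁻ prev' x∈)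

  valid-snoc : ∀ {prev} R {P} → Valid prev R → Attached (λ x → x ∈ prev ++ concat R) P →
               Valid prev (R ++ P ∷ [])
  valid-snoc {prev} [] _ at =
    attach-step (attached-resp (λ {x} → subst (x ∈_) (++-identityʳ prev)) (λ _ → ∈-++⁺ˡ) at) tt
  valid-snoc {prev} (Q ∷ R) (h , U , rest) at =
    h , U , valid-snoc R rest (attached-resp (λ {x} → subst (x ∈_) (sym (++-assoc prev Q (concat R))))
                                             (λ {x} _ → subst (x ∈_) (++-assoc prev Q (concat R))) at)

  -- A tree grown from a brrb-path by attaching paths, recorded newest path first.
  data Built : Paths → Set where
    base : ∀ {Q} → Unique Q → Coloured Q brrb → Built (Q ∷ [])
    add  : ∀ {Ps P} → Built Ps → Attached (Vert Ps) P → Built (P ∷ Ps)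

  built : ∀ {Ps prev} R → Built Ps → (∀ {x} → x ∈ prev → Vert Ps x) → (∀ {x} → Vert Ps x → x ∈ prev) →
          Valid prev R → Σ Paths λ Ps' → Built Ps' × Ps' ≋ (Ps ++ R)
  built {Ps} [] b _ _ _ = Ps , b , subst (Ps ≋_) (sym (++-identityʳ Ps)) ≋-refl
  built {Ps} {prev} (P ∷ R) b to from va@(_ , _ , rest)
    with built R (add b (attached-resp to (λ _ → from) (first-attached va))) to' from' rest
    where
      to' : ∀ {x} → x ∈ prev ++ P → Vert (P ∷ Ps) x
      to' = [ there ∘ to , here ]′ ∘ ∈-++⁻ prev

      from' : ∀ {x} → Vert (P ∷ Ps) x → x ∈ prev ++ P
      from' (here x∈P) = ∈-++⁺ʳ prev x∈P
      from' (there x)  = ∈-++⁺ˡ (from x)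
  ... | Ps' , b' , eq = Ps' , b' , ≋-trans eq (↭⇒≋ (↭-sym (shift P Ps R)))

  Rebuilt : Paths → List V → Set
  Rebuilt Ps ys = Σ Paths λ R → Valid ys R × (ys ∷ R) ≋ Ps

  Rerootable : Paths → Set
  Rerootable Ps = ∀ {ys} → Brrb (Edge Ps) ys → Rebuilt Ps ys

  rebuilt-self : ∀ {Q} → Rebuilt (Q ∷ []) Q
  rebuilt-self = [] , tt , ≋-refl

  rebuilt-≋ : ∀ {Ps Ps' ys} → Ps ≋ Ps' → Rebuilt Ps ys → Rebuilt Ps' ys
  rebuilt-≋ eq (R , va , eq') = R , va , ≋-trans eq' eq

  rebuilt-reverse : ∀ {Ps ys} → Rebuilt Ps (reverse ys) → Rebuilt Ps ys
  rebuilt-reverse {ys = ys} (R , va , eq) =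
    R , valid-resp R Anyₚ.reverse⁻ (λ x∈ys _ → Anyₚ.reverse⁺ x∈ys) va ,
    ≋-trans (++-cong-≋ (≋-sym (reverse-≋ ys)) ≋-refl) eq

  rebuilt-extend : ∀ {Ps P ys} → Attached (Vert Ps) P → Rebuilt Ps ys → Rebuilt (P ∷ Ps) ys
  rebuilt-extend {Ps} {P} {ys} at (R , va , eq) =
    R ++ P ∷ [] ,
    valid-snoc R va (attached-resp (∈-concat⁺ ∘ vert (proj₂ eq)) (λ _ → vert (proj₁ eq) ∘ ∈-concat⁻ (ys ∷ R)) at) ,
    ≋-trans (++-cong-≋ eq (≋-refl {P ∷ []})) (↭⇒≋ (++-comm Ps (P ∷ [])))

  pair⁺ : ∀ {A B : List V} {x} → x ∈ A ++ B → Vert (A ∷ B ∷ []) x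
  pair⁺ {A} x∈ with ∈-++⁻ A x∈
  ... | inj₁ x∈A = here x∈A
  ... | inj₂ x∈B = there (here x∈B)

  pair⁻ : ∀ {A B : List V} {x} → Vert (A ∷ B ∷ []) x → x ∈ A ++ B
  pair⁻ (here x∈A)             = ∈-++⁺ˡ x∈A
  pair⁻ {A} (there (here x∈B)) = ∈-++⁺ʳ A x∈B
  pair⁻ (there (there ()))

  -- Regrouping: if the new path Pt together with an old path O draws the same graph as F and P1,
  -- where P1 can be attached to F, and Pt meets the old tree only inside O, then a sequence of the
  -- old tree starting at O becomes a sequence of the new tree starting at F, P1.
  reroute : ∀ {Ps Pt O F P1} → Attached (_∈ F) P1 → (F ∷ P1 ∷ []) ≋ (Pt ∷ O ∷ []) →
            (∀ {x} → x ∈ Pt → Vert Ps x → x ∈ O) → Rebuilt Ps O → Rebuilt (Pt ∷ Ps) F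
  reroute {Ps} {Pt} {O} {F} {P1} second splice old-in-O (R , va , eq) =
    P1 ∷ R , attach-step second (valid-resp R into back va) ,
    ≋-trans (++-cong-≋ splice ≋-refl) (++-cong-≋ {Pt ∷ []} ≋-refl eq)
    where
      into : ∀ {x} → x ∈ O → x ∈ F ++ P1
      into x∈O = pair⁻ (vert (proj₂ splice) (there (here x∈O)))

      back : ∀ {x} → x ∈ F ++ P1 → x ∈ concat R → x ∈ O
      back x∈ x∈R with vert (proj₁ splice) (pair⁺ x∈)
      ... | here x∈Pt        = old-in-O x∈Pt (vert (proj₁ eq) (there (∈-concat⁻ R x∈R)))
      ... | there (here x∈O) = x∈O
      ... | there (there ())

  Apart : List V → List V → Set
  Apart xs ys = All (λ x → All (x ≢_) ys) xs

  split-at : ∀ {j x : V} zs zs' → x ∈ zs ++ j ∷ zs' → x ≡ j ⊎ x ∈ zs ++ zs'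
  split-at []       zs' (here x≡j)  = inj₁ x≡j
  split-at []       zs' (there x∈)  = inj₂ x∈
  split-at (z ∷ zs) zs' (here x≡z)  = inj₂ (here x≡z)
  split-at (z ∷ zs) zs' (there x∈)  = Sum.map₂ there (split-at zs zs' x∈)

  meet-at : ∀ {j} xs xs' ys ys' → Apart (xs ++ xs') (ys ++ ys') →
            ∀ {x} → x ∈ xs ++ j ∷ xs' → x ∈ ys ++ j ∷ ys' → x ≡ j
  meet-at xs xs' ys ys' apart x∈ x∈' with split-at xs xs' x∈ | split-at ys ys' x∈'
  ... | inj₁ x≡j | _        = x≡j
  ... | inj₂ _   | inj₁ x≡j = x≡j
  ... | inj₂ i   | inj₂ i'  = ⊥-elim (All.lookup (All.lookup apart i) i' refl)

  br4 : ∀ {a b c d u v : V} → Black a → Red b → Red c → Black d →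
        PathEdge (a ∷ b ∷ c ∷ d ∷ []) u v → Black u → Red v → (u ≡ a × v ≡ b) ⊎ (u ≡ d × v ≡ c)
  br4 _ _  _  _ (inj₁ here)                 _  _ = inj₁ (refl , refl)
  br4 _ cb _  _ (inj₁ (there here))         bu _ = ⊥-elim (clash bu cb)
  br4 _ _  cc _ (inj₁ (there (there here))) bu _ = ⊥-elim (clash bu cc)
  br4 _ cb _  _ (inj₂ here)                 bu _ = ⊥-elim (clash bu cb)
  br4 _ _  cc _ (inj₂ (there here))         bu _ = ⊥-elim (clash bu cc)
  br4 _ _  _  _ (inj₂ (there (there here))) _  _ = inj₂ (refl , refl)
  br4 _ _  _  _ (inj₁ (there (there (there (there ()))))) _ _
  br4 _ _  _  _ (inj₂ (there (there (there (there ()))))) _ _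

  rr4 : ∀ {a b c d u v : V} → Black a → Red b → Red c → Black d →
        PathEdge (a ∷ b ∷ c ∷ d ∷ []) u v → Red u → Red v → (u ≡ b × v ≡ c) ⊎ (u ≡ c × v ≡ b)
  rr4 ca _ _ _  (inj₁ here)                 ru _  = ⊥-elim (clash ca ru)
  rr4 _  _ _ _  (inj₁ (there here))         _  _  = inj₁ (refl , refl)
  rr4 _  _ _ cd (inj₁ (there (there here))) _  rv = ⊥-elim (clash cd rv)
  rr4 ca _ _ _  (inj₂ here)                 _  rv = ⊥-elim (clash ca rv)
  rr4 _  _ _ _  (inj₂ (there here))         _  _  = inj₂ (refl , refl)
  rr4 _  _ _ cd (inj₂ (there (there here))) ru _  = ⊥-elim (clash cd ru)
  rr4 _  _ _ _  (inj₁ (there (there (there (there ()))))) _ _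
  rr4 _  _ _ _  (inj₂ (there (there (there (there ()))))) _ _

  br5 : ∀ {a b c d e u v : V} → Black a → Red b → Red c → Red d → Black e →
        PathEdge (a ∷ b ∷ c ∷ d ∷ e ∷ []) u v → Black u → Red v → (u ≡ a × v ≡ b) ⊎ (u ≡ e × v ≡ d)
  br5 _ _  _  _  _ (inj₁ here)                         _  _ = inj₁ (refl , refl)
  br5 _ cb _  _  _ (inj₁ (there here))                 bu _ = ⊥-elim (clash bu cb)
  br5 _ _  cc _  _ (inj₁ (there (there here)))         bu _ = ⊥-elim (clash bu cc)
  br5 _ _  _  cd _ (inj₁ (there (there (there here)))) bu _ = ⊥-elim (clash bu cd)
  br5 _ cb _  _  _ (inj₂ here)                         bu _ = ⊥-elim (clash bu cb)
  br5 _ _  cc _  _ (inj₂ (there here))                 bu _ = ⊥-elim (clash bu cc)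
  br5 _ _  _  cd _ (inj₂ (there (there here)))         bu _ = ⊥-elim (clash bu cd)
  br5 _ _  _  _  _ (inj₂ (there (there (there here)))) _  _ = inj₂ (refl , refl)
  br5 _ _  _  _  _ (inj₁ (there (there (there (there (there ())))))) _ _
  br5 _ _  _  _  _ (inj₂ (there (there (there (there (there ())))))) _ _

  rr5 : ∀ {a b c d e u v : V} → Black a → Red b → Red c → Red d → Black e →
        PathEdge (a ∷ b ∷ c ∷ d ∷ e ∷ []) u v → Red u → Red v →
        (u ≡ b × v ≡ c) ⊎ (u ≡ c × v ≡ b) ⊎ (u ≡ c × v ≡ d) ⊎ (u ≡ d × v ≡ c)
  rr5 ca _ _ _ _  (inj₁ here)                         ru _  = ⊥-elim (clash ca ru)
  rr5 _  _ _ _ _  (inj₁ (there here))                 _  _  = inj₁ (refl , refl)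
  rr5 _  _ _ _ _  (inj₁ (there (there here)))         _  _  = inj₂ (inj₂ (inj₁ (refl , refl)))
  rr5 _  _ _ _ ce (inj₁ (there (there (there here)))) _  rv = ⊥-elim (clash ce rv)
  rr5 ca _ _ _ _  (inj₂ here)                         _  rv = ⊥-elim (clash ca rv)
  rr5 _  _ _ _ _  (inj₂ (there here))                 _  _  = inj₂ (inj₁ (refl , refl))
  rr5 _  _ _ _ _  (inj₂ (there (there here)))         _  _  = inj₂ (inj₂ (inj₂ (refl , refl)))
  rr5 _  _ _ _ ce (inj₂ (there (there (there here)))) ru _  = ⊥-elim (clash ce ru)
  rr5 _  _ _ _ _  (inj₁ (there (there (there (there (there ())))))) _ _
  rr5 _  _ _ _ _  (inj₂ (there (there (there (there (there ())))))) _ _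

  br7 : ∀ {a b c d e f g u v : V} → Black a → Red b → Red c → Black d → Red e → Red f → Black g →
        PathEdge (a ∷ b ∷ c ∷ d ∷ e ∷ f ∷ g ∷ []) u v → Black u → Red v →
        (u ≡ a × v ≡ b) ⊎ (u ≡ d × v ≡ c) ⊎ (u ≡ d × v ≡ e) ⊎ (u ≡ g × v ≡ f)
  br7 _ _  _  _ _  _  _ (inj₁ here)                                         _  _ = inj₁ (refl , refl)
  br7 _ cb _  _ _  _  _ (inj₁ (there here))                                 bu _ = ⊥-elim (clash bu cb)
  br7 _ _  cc _ _  _  _ (inj₁ (there (there here)))                         bu _ = ⊥-elim (clash bu cc)
  br7 _ _  _  _ _  _  _ (inj₁ (there (there (there here))))                 _  _ = inj₂ (inj₂ (inj₁ (refl , refl)))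
  br7 _ _  _  _ ce _  _ (inj₁ (there (there (there (there here)))))         bu _ = ⊥-elim (clash bu ce)
  br7 _ _  _  _ _  cf _ (inj₁ (there (there (there (there (there here)))))) bu _ = ⊥-elim (clash bu cf)
  br7 _ cb _  _ _  _  _ (inj₂ here)                                         bu _ = ⊥-elim (clash bu cb)
  br7 _ _  cc _ _  _  _ (inj₂ (there here))                                 bu _ = ⊥-elim (clash bu cc)
  br7 _ _  _  _ _  _  _ (inj₂ (there (there here)))                         _  _ = inj₂ (inj₁ (refl , refl))
  br7 _ _  _  _ ce _  _ (inj₂ (there (there (there here))))                 bu _ = ⊥-elim (clash bu ce)
  br7 _ _  _  _ _  cf _ (inj₂ (there (there (there (there here)))))         bu _ = ⊥-elim (clash bu cf)
  br7 _ _  _  _ _  _  _ (inj₂ (there (there (there (there (there here)))))) _  _ = inj₂ (inj₂ (inj₂ (refl , refl)))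
  br7 _ _  _  _ _  _  _ (inj₁ (there (there (there (there (there (there (there ())))))))) _ _
  br7 _ _  _  _ _  _  _ (inj₂ (there (there (there (there (there (there (there ())))))))) _ _

  rr7 : ∀ {a b c d e f g u v : V} → Black a → Red b → Red c → Black d → Red e → Red f → Black g →
        PathEdge (a ∷ b ∷ c ∷ d ∷ e ∷ f ∷ g ∷ []) u v → Red u → Red v →
        (u ≡ b × v ≡ c) ⊎ (u ≡ c × v ≡ b) ⊎ (u ≡ e × v ≡ f) ⊎ (u ≡ f × v ≡ e)
  rr7 ca _ _ _  _ _ _  (inj₁ here)                                         ru _  = ⊥-elim (clash ca ru)
  rr7 _  _ _ _  _ _ _  (inj₁ (there here))                                 _  _  = inj₁ (refl , refl)
  rr7 _  _ _ cd _ _ _  (inj₁ (there (there here)))                         _  rv = ⊥-elim (clash cd rv)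
  rr7 _  _ _ cd _ _ _  (inj₁ (there (there (there here))))                 ru _  = ⊥-elim (clash cd ru)
  rr7 _  _ _ _  _ _ _  (inj₁ (there (there (there (there here)))))         _  _  = inj₂ (inj₂ (inj₁ (refl , refl)))
  rr7 _  _ _ _  _ _ cg (inj₁ (there (there (there (there (there here)))))) _  rv = ⊥-elim (clash cg rv)
  rr7 ca _ _ _  _ _ _  (inj₂ here)                                         _  rv = ⊥-elim (clash ca rv)
  rr7 _  _ _ _  _ _ _  (inj₂ (there here))                                 _  _  = inj₂ (inj₁ (refl , refl))
  rr7 _  _ _ cd _ _ _  (inj₂ (there (there here)))                         ru _  = ⊥-elim (clash cd ru)
  rr7 _  _ _ cd _ _ _  (inj₂ (there (there (there here))))                 _  rv = ⊥-elim (clash cd rv)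
  rr7 _  _ _ _  _ _ _  (inj₂ (there (there (there (there here)))))         _  _  = inj₂ (inj₂ (inj₂ (refl , refl)))
  rr7 _  _ _ _  _ _ cg (inj₂ (there (there (there (there (there here)))))) ru _  = ⊥-elim (clash cg ru)
  rr7 _  _ _ _  _ _ _  (inj₁ (there (there (there (there (there (there (there ())))))))) _ _
  rr7 _  _ _ _  _ _ _  (inj₂ (there (there (there (there (there (there (there ())))))))) _ _

  -- A path a b c d e attached at c (k = 4): its colours, the distinctness facts not implied by
  -- the colours, and how it meets the old tree Ps.
  record Arm4 (Ps : Paths) (a b c d e : V) : Set where
    constructor arm4-facts
    field
      ca : Black a ; cb : Red b ; cc : Red c ; cd : Red d ; ce : Black e
      a≢e : a ≢ e ; b≢c : b ≢ c ; b≢d : b ≢ d ; c≢d : c ≢ d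
      anchored : Vert Ps c
      only     : ∀ {x} → x ∈ a ∷ b ∷ c ∷ d ∷ e ∷ [] → Vert Ps x → x ≡ c

  arm4 : ∀ {Ps a b c d e} → Attached (Vert Ps) (a ∷ b ∷ c ∷ d ∷ e ∷ []) → Arm4 Ps a b c d e
  arm4 (attached _ _ k4 (ca ∷ cb ∷ cc ∷ cd ∷ ce ∷ [])
                 ((_ ∷ _ ∷ _ ∷ a≢e ∷ []) ∷ (b≢c ∷ b≢d ∷ _) ∷ (c≢d ∷ _) ∷ _) jm only) =
    arm4-facts ca cb cc cd ce a≢e b≢c b≢d c≢d jm only

  mirror4 : ∀ {Ps a b c d e} → Arm4 Ps a b c d e → Arm4 Ps e d c b a
  mirror4 (arm4-facts ca cb cc cd ce a≢e b≢c b≢d c≢d jm only) =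
    arm4-facts ce cd cc cb ca (≢-sym a≢e) (≢-sym c≢d) (≢-sym b≢d) (≢-sym b≢c) jm
               (λ x∈ → only (Anyₚ.reverse⁻ x∈))

  record Arm6 (Ps : Paths) (a b c d e f g : V) : Set where
    constructor arm6-facts
    field
      ca : Black a ; cb : Red b ; cc : Red c ; cd : Black d ; ce : Red e ; cf : Red f ; cg : Black g
      a≢d : a ≢ d ; a≢g : a ≢ g ; d≢g : d ≢ g
      b≢c : b ≢ c ; b≢e : b ≢ e ; b≢f : b ≢ f ; c≢e : c ≢ e ; c≢f : c ≢ f ; e≢f : e ≢ f
      anchored : Vert Ps d
      only     : ∀ {x} → x ∈ a ∷ b ∷ c ∷ d ∷ e ∷ f ∷ g ∷ [] → Vert Ps x → x ≡ d

  arm6 : ∀ {Ps a b c d e f g} → Attached (Vert Ps) (a ∷ b ∷ c ∷ d ∷ e ∷ f ∷ g ∷ []) → Arm6 Ps a b c d e f g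
  arm6 (attached _ _ k6 (ca ∷ cb ∷ cc ∷ cd ∷ ce ∷ cf ∷ cg ∷ [])
                 ( (_ ∷ _ ∷ a≢d ∷ _ ∷ _ ∷ a≢g ∷ []) ∷ (b≢c ∷ _ ∷ b≢e ∷ b≢f ∷ _) ∷ (_ ∷ c≢e ∷ c≢f ∷ _) ∷
                   (_ ∷ _ ∷ d≢g ∷ []) ∷ (e≢f ∷ _) ∷ _ ) jm only) =
    arm6-facts ca cb cc cd ce cf cg a≢d a≢g d≢g b≢c b≢e b≢f c≢e c≢f e≢f jm only

  mirror6 : ∀ {Ps a b c d e f g} → Arm6 Ps a b c d e f g → Arm6 Ps g f e d c b a
  mirror6 (arm6-facts ca cb cc cd ce cf cg a≢d a≢g d≢g b≢c b≢e b≢f c≢e c≢f e≢f jm only) =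
    arm6-facts cg cf ce cd cc cb ca (≢-sym d≢g) (≢-sym a≢g) (≢-sym a≢d)
               (≢-sym e≢f) (≢-sym c≢f) (≢-sym b≢f) (≢-sym c≢e) (≢-sym b≢e) (≢-sym b≢c) jm
               (λ x∈ → only (Anyₚ.reverse⁻ x∈))

  Neighbour : (V → Set) → Paths → V → Set
  Neighbour C Ps x = Σ V λ y → C y × Edge Ps x y

  Extension : Paths → V → V → Set
  Extension Ps z c = Σ V λ r → Σ V λ w → Brrb (Edge Ps) (z ∷ c ∷ r ∷ w ∷ [])

  data Route (Ps : Paths) (Entry : List V → Set) (ys : List V) : Set where
    old      : Brrb (Edge Ps) ys → Route Ps Entry ys
    entering : Entry ys → Route Ps Entry ys
    reversed : Entry (reverse ys) → Route Ps Entry ys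

  RedEndsNew : Paths → List V → Set
  RedEndsNew Ps Pt = ∀ {u v} → PathEdge Pt u v → Black u → Red v → Vert Ps v → ⊥

  old-path : ∀ {Ps Pt y0 y1 y2 y3} → RedEndsNew Ps Pt → Brrb (Edge (Pt ∷ Ps)) (y0 ∷ y1 ∷ y2 ∷ y3 ∷ []) →
             Edge Ps y1 y2 → Brrb (Edge Ps) (y0 ∷ y1 ∷ y2 ∷ y3 ∷ [])
  old-path {Ps} {Pt} new (U , e01 ∷ _ ∷ e23 ∷ [-] , col@(c0 ∷ c1 ∷ c2 ∷ c3 ∷ [])) o12 =
    U , old-edge e01 c0 c1 (proj₁ (edge-ends o12)) ∷ o12 ∷
        edge-sym (old-edge (edge-sym e23) c3 c2 (proj₂ (edge-ends o12))) ∷ [-] , col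
    where
      old-edge : ∀ {u v} → Edge (Pt ∷ Ps) u v → Black u → Red v → Vert Ps v → Edge Ps u v
      old-edge (here pe) bu rv v-old = ⊥-elim (new pe bu rv v-old)
      old-edge (there o) _  _  _     = o

  splice4 : ∀ {a b c d e z r w : V} →
    ((a ∷ b ∷ c ∷ z ∷ []) ∷ (e ∷ d ∷ c ∷ r ∷ w ∷ []) ∷ []) ≋ ((a ∷ b ∷ c ∷ d ∷ e ∷ []) ∷ (z ∷ c ∷ r ∷ w ∷ []) ∷ [])
  splice4 =
    drawn⇒⊑ ( walk (fwd here ∷ fwd (there here) ∷ there (bwd here) ∷ [-])
            ∷ walk (bwd (there (there (there here))) ∷ bwd (there (there here)) ∷
                    there (fwd (there here)) ∷ there (fwd (there (there here))) ∷ [-])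
            ∷ []) ,
    drawn⇒⊑ ( walk (fwd here ∷ fwd (there here) ∷ there (bwd (there here)) ∷ there (bwd here) ∷ [-])
            ∷ walk (bwd (there (there here)) ∷ there (fwd (there (there here))) ∷
                    there (fwd (there (there (there here)))) ∷ [-])
            ∷ [])

  splice6 : ∀ {a b c d e f g r s w : V} →
    ((a ∷ b ∷ c ∷ d ∷ []) ∷ (g ∷ f ∷ e ∷ d ∷ r ∷ s ∷ w ∷ []) ∷ []) ≋
    ((a ∷ b ∷ c ∷ d ∷ e ∷ f ∷ g ∷ []) ∷ (d ∷ r ∷ s ∷ w ∷ []) ∷ [])
  splice6 =
    drawn⇒⊑ ( walk (fwd here ∷ fwd (there here) ∷ fwd (there (there here)) ∷ [-])
            ∷ walk (bwd (there (there (there (there (there here))))) ∷ bwd (there (there (there (there here)))) ∷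
                    bwd (there (there (there here))) ∷ there (fwd here) ∷ there (fwd (there here)) ∷
                    there (fwd (there (there here))) ∷ [-])
            ∷ []) ,
    drawn⇒⊑ ( walk (fwd here ∷ fwd (there here) ∷ fwd (there (there here)) ∷ there (bwd (there (there here))) ∷
                    there (bwd (there here)) ∷ there (bwd here) ∷ [-])
            ∷ walk (there (fwd (there (there (there here)))) ∷ there (fwd (there (there (there (there here))))) ∷
                    there (fwd (there (there (there (there (there here)))))) ∷ [-])
            ∷ [])

  data Entry4 (Ps : Paths) (a b c d e : V) : List V → Set where
    via-ab : ∀ {z} → Black z → Edge Ps c z → Entry4 Ps a b c d e (a ∷ b ∷ c ∷ z ∷ [])
    via-ed : ∀ {z} → Black z → Edge Ps c z → Entry4 Ps a b c d e (e ∷ d ∷ c ∷ z ∷ [])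

  module Attach4 {Ps : Paths} {a b c d e : V} (A : Arm4 Ps a b c d e) where
    open Arm4 A

    Pt : List V
    Pt = a ∷ b ∷ c ∷ d ∷ e ∷ []

    fresh : ∀ {x y} → x ∈ Pt → x ≢ c → Vert Ps y → x ≢ y
    fresh x∈Pt x≢c y-old refl = x≢c (only x∈Pt y-old)

    red-ends-new : RedEndsNew Ps Pt
    red-ends-new pe bu rv v-old with br5 ca cb cc cd ce pe bu rv
    ... | inj₁ (refl , refl) = b≢c (only (there (here refl)) v-old)
    ... | inj₂ (refl , refl) = c≢d (sym (only (there (there (there (here refl)))) v-old))

    toward-b : ∀ {y} → Edge (Pt ∷ Ps) y b → Black y → y ≡ a
    toward-b (there o) _ = ⊥-elim (b≢c (only (there (here refl)) (proj₂ (edge-ends o))))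
    toward-b (here pe) by with br5 ca cb cc cd ce pe by cb
    ... | inj₁ (y≡a , _) = y≡a
    ... | inj₂ (_ , b≡d) = ⊥-elim (b≢d b≡d)

    toward-d : ∀ {y} → Edge (Pt ∷ Ps) y d → Black y → y ≡ e
    toward-d (there o) _ = ⊥-elim (c≢d (sym (only (there (there (there (here refl)))) (proj₂ (edge-ends o)))))
    toward-d (here pe) by with br5 ca cb cc cd ce pe by cd
    ... | inj₁ (_ , d≡b) = ⊥-elim (b≢d (sym d≡b))
    ... | inj₂ (y≡e , _) = y≡e

    from-joint : ∀ {y} → Edge (Pt ∷ Ps) c y → Black y → Edge Ps c y
    from-joint (there o) _ = o
    from-joint (here pe) by with br5 ca cb cc cd ce (pathEdge-sym pe) by cc
    ... | inj₁ (_ , c≡b) = ⊥-elim (b≢c (sym c≡b))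
    ... | inj₂ (_ , c≡d) = ⊥-elim (c≢d c≡d)

    through-b : ∀ {y0 y3} → Black y0 → Black y3 → Edge (Pt ∷ Ps) y0 b → Edge (Pt ∷ Ps) c y3 →
                Entry4 Ps a b c d e (y0 ∷ b ∷ c ∷ y3 ∷ [])
    through-b b0 b3 e0 e3 with toward-b e0 b0
    ... | refl = via-ab b3 (from-joint e3 b3)

    through-d : ∀ {y0 y3} → Black y0 → Black y3 → Edge (Pt ∷ Ps) y0 d → Edge (Pt ∷ Ps) c y3 →
                Entry4 Ps a b c d e (y0 ∷ d ∷ c ∷ y3 ∷ [])
    through-d b0 b3 e0 e3 with toward-d e0 b0
    ... | refl = via-ed b3 (from-joint e3 b3)

    route : ∀ {ys} → Brrb (Edge (Pt ∷ Ps)) ys → Route Ps (Entry4 Ps a b c d e) ys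
    route p@(_ , _ ∷ there o12 ∷ _ ∷ [-] , _ ∷ _ ∷ _ ∷ _ ∷ []) = old (old-path red-ends-new p o12)
    route (_ , e01 ∷ here pe ∷ e23 ∷ [-] , c0 ∷ c1 ∷ c2 ∷ c3 ∷ []) with rr5 ca cb cc cd ce pe c1 c2
    ... | inj₁ (refl , refl)               = entering (through-b c0 c3 e01 e23)
    ... | inj₂ (inj₁ (refl , refl))        = reversed (through-b c3 c0 (edge-sym e23) (edge-sym e01))
    ... | inj₂ (inj₂ (inj₁ (refl , refl))) = reversed (through-d c3 c0 (edge-sym e23) (edge-sym e01))
    ... | inj₂ (inj₂ (inj₂ (refl , refl))) = entering (through-d c0 c3 e01 e23)

    -- A new black–red edge continues through the joint into the old tree.
    extension : Neighbour Black Ps c → ∀ {z v} → PathEdge Pt z v → Black z → Red v → Extension (Pt ∷ Ps) z v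
    extension (w , cw , c-w) pe bz rv with br5 ca cb cc cd ce pe bz rv
    ... | inj₁ (refl , refl) =
      c , w , brrb-path ca cb cc cw (fresh (here refl) (black≢red ca cc) (proj₂ (edge-ends c-w))) b≢c
                        (fwd here) (fwd (there here)) (there c-w)
    ... | inj₂ (refl , refl) =
      c , w , brrb-path ce cd cc cw (fresh (there (there (there (there (here refl))))) (black≢red ce cc)
                                           (proj₂ (edge-ends c-w)))
                        (≢-sym c≢d) (bwd (there (there (there here)))) (bwd (there (there here))) (there c-w)

    -- Given a brrb-path z c r w of the old tree, a b c z starts a sequence of the new tree that
    -- adds e d c r w next.
    through-a : ∀ {z r w} → Brrb (Edge Ps) (z ∷ c ∷ r ∷ w ∷ []) → Rebuilt Ps (z ∷ c ∷ r ∷ w ∷ []) →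
                Rebuilt (Pt ∷ Ps) (a ∷ b ∷ c ∷ z ∷ [])
    through-a {z} {r} {w} (((_ ∷ _ ∷ z≢w ∷ []) ∷ (c≢r ∷ _) ∷ _) , z-c ∷ c-r ∷ r-w ∷ [-] , cz ∷ _ ∷ cr ∷ cw ∷ []) =
      reroute second splice4 (λ x∈Pt x-old → subst (_∈ z ∷ c ∷ r ∷ w ∷ []) (sym (only x∈Pt x-old)) (there (here refl)))
      where
        z-old : Vert Ps z
        z-old = proj₁ (edge-ends z-c)
        r-old : Vert Ps r
        r-old = proj₂ (edge-ends c-r)
        w-old : Vert Ps w
        w-old = proj₂ (edge-ends r-w)
        a-new : ∀ {y} → Vert Ps y → a ≢ y
        a-new = fresh (here refl) (black≢red ca cc)
        b-new : ∀ {y} → Vert Ps y → b ≢ y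
        b-new = fresh (there (here refl)) b≢c
        d-new : ∀ {y} → Vert Ps y → d ≢ y
        d-new = fresh (there (there (there (here refl)))) (≢-sym c≢d)
        e-new : ∀ {y} → Vert Ps y → e ≢ y
        e-new = fresh (there (there (there (there (here refl))))) (black≢red ce cc)

        second : Attached (_∈ a ∷ b ∷ c ∷ z ∷ []) (e ∷ d ∷ c ∷ r ∷ w ∷ [])
        second = attached c _ k4 (ce ∷ cd ∷ cc ∷ cr ∷ cw ∷ [])
          ( (black≢red ce cd ∷ black≢red ce cc ∷ black≢red ce cr ∷ e-new w-old ∷ []) ∷
            (≢-sym c≢d ∷ d-new r-old ∷ red≢black cd cw ∷ []) ∷
            (c≢r ∷ red≢black cc cw ∷ []) ∷ (red≢black cr cw ∷ []) ∷ [] ∷ [] )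
          (there (there (here refl)))
          (meet-at (e ∷ d ∷ []) (r ∷ w ∷ []) (a ∷ b ∷ []) (z ∷ [])
            ( (≢-sym a≢e ∷ black≢red ce cb ∷ e-new z-old ∷ []) ∷
              (red≢black cd ca ∷ ≢-sym b≢d ∷ red≢black cd cz ∷ []) ∷
              (≢-sym (a-new r-old) ∷ ≢-sym (b-new r-old) ∷ red≢black cr cz ∷ []) ∷
              (≢-sym (a-new w-old) ∷ black≢red cw cb ∷ ≢-sym z≢w ∷ []) ∷ [] ))

  data Entry6 (a b c d e f g : V) : List V → Set where
    via-abc : Entry6 a b c d e f g (a ∷ b ∷ c ∷ d ∷ [])
    via-gfe : Entry6 a b c d e f g (g ∷ f ∷ e ∷ d ∷ [])

  module Attach6 {Ps : Paths} {a b c d e f g : V} (A : Arm6 Ps a b c d e f g) where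
    open Arm6 A

    Pt : List V
    Pt = a ∷ b ∷ c ∷ d ∷ e ∷ f ∷ g ∷ []

    -- The vertices of Pt other than the (black) joint are new; in particular all red ones are.
    fresh : ∀ {x y} → x ∈ Pt → x ≢ d → Vert Ps y → x ≢ y
    fresh x∈Pt x≢d y-old refl = x≢d (only x∈Pt y-old)

    red-new : ∀ {v} → v ∈ Pt → Red v → Vert Ps v → ⊥
    red-new v∈Pt rv v-old = black≢red cd rv (sym (only v∈Pt v-old))

    red-ends-new : RedEndsNew Ps Pt
    red-ends-new pe _ rv = red-new (proj₂ (pathEdge-ends pe)) rv

    toward-b : ∀ {y} → Edge (Pt ∷ Ps) y b → Black y → y ≡ a
    toward-b (there o) _ = ⊥-elim (red-new (there (here refl)) cb (proj₂ (edge-ends o)))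
    toward-b (here pe) by with br7 ca cb cc cd ce cf cg pe by cb
    ... | inj₁ (y≡a , _)               = y≡a
    ... | inj₂ (inj₁ (_ , b≡c))        = ⊥-elim (b≢c b≡c)
    ... | inj₂ (inj₂ (inj₁ (_ , b≡e))) = ⊥-elim (b≢e b≡e)
    ... | inj₂ (inj₂ (inj₂ (_ , b≡f))) = ⊥-elim (b≢f b≡f)

    toward-c : ∀ {y} → Edge (Pt ∷ Ps) y c → Black y → y ≡ d
    toward-c (there o) _ = ⊥-elim (red-new (there (there (here refl))) cc (proj₂ (edge-ends o)))
    toward-c (here pe) by with br7 ca cb cc cd ce cf cg pe by cc
    ... | inj₁ (_ , c≡b)               = ⊥-elim (b≢c (sym c≡b))
    ... | inj₂ (inj₁ (y≡d , _))        = y≡d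
    ... | inj₂ (inj₂ (inj₁ (_ , c≡e))) = ⊥-elim (c≢e c≡e)
    ... | inj₂ (inj₂ (inj₂ (_ , c≡f))) = ⊥-elim (c≢f c≡f)

    toward-e : ∀ {y} → Edge (Pt ∷ Ps) y e → Black y → y ≡ d
    toward-e (there o) _ = ⊥-elim (red-new (there (there (there (there (here refl))))) ce (proj₂ (edge-ends o)))
    toward-e (here pe) by with br7 ca cb cc cd ce cf cg pe by ce
    ... | inj₁ (_ , e≡b)               = ⊥-elim (b≢e (sym e≡b))
    ... | inj₂ (inj₁ (_ , e≡c))        = ⊥-elim (c≢e (sym e≡c))
    ... | inj₂ (inj₂ (inj₁ (y≡d , _))) = y≡d
    ... | inj₂ (inj₂ (inj₂ (_ , e≡f))) = ⊥-elim (e≢f e≡f)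

    toward-f : ∀ {y} → Edge (Pt ∷ Ps) y f → Black y → y ≡ g
    toward-f (there o) _ = ⊥-elim (red-new (there (there (there (there (there (here refl)))))) cf (proj₂ (edge-ends o)))
    toward-f (here pe) by with br7 ca cb cc cd ce cf cg pe by cf
    ... | inj₁ (_ , f≡b)               = ⊥-elim (b≢f (sym f≡b))
    ... | inj₂ (inj₁ (_ , f≡c))        = ⊥-elim (c≢f (sym f≡c))
    ... | inj₂ (inj₂ (inj₁ (_ , f≡e))) = ⊥-elim (e≢f (sym f≡e))
    ... | inj₂ (inj₂ (inj₂ (y≡g , _))) = y≡g

    through-bc : ∀ {y0 y3} → Black y0 → Black y3 → Edge (Pt ∷ Ps) y0 b → Edge (Pt ∷ Ps) c y3 →
                 Entry6 a b c d e f g (y0 ∷ b ∷ c ∷ y3 ∷ [])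
    through-bc b0 b3 e0 e3 with toward-b e0 b0 | toward-c (edge-sym e3) b3
    ... | refl | refl = via-abc

    through-fe : ∀ {y0 y3} → Black y0 → Black y3 → Edge (Pt ∷ Ps) y0 f → Edge (Pt ∷ Ps) e y3 →
                 Entry6 a b c d e f g (y0 ∷ f ∷ e ∷ y3 ∷ [])
    through-fe b0 b3 e0 e3 with toward-f e0 b0 | toward-e (edge-sym e3) b3
    ... | refl | refl = via-gfe

    route : ∀ {ys} → Brrb (Edge (Pt ∷ Ps)) ys → Route Ps (Entry6 a b c d e f g) ys
    route p@(_ , _ ∷ there o12 ∷ _ ∷ [-] , _ ∷ _ ∷ _ ∷ _ ∷ []) = old (old-path red-ends-new p o12)
    route (_ , e01 ∷ here pe ∷ e23 ∷ [-] , c0 ∷ c1 ∷ c2 ∷ c3 ∷ []) with rr7 ca cb cc cd ce cf cg pe c1 c2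
    ... | inj₁ (refl , refl)               = entering (through-bc c0 c3 e01 e23)
    ... | inj₂ (inj₁ (refl , refl))        = reversed (through-bc c3 c0 (edge-sym e23) (edge-sym e01))
    ... | inj₂ (inj₂ (inj₁ (refl , refl))) = reversed (through-fe c3 c0 (edge-sym e23) (edge-sym e01))
    ... | inj₂ (inj₂ (inj₂ (refl , refl))) = entering (through-fe c0 c3 e01 e23)

    -- A new black–red edge lies on one of the arms a b c d, g f e d of Pt.
    extension : ∀ {z v} → PathEdge Pt z v → Black z → Red v → Extension (Pt ∷ Ps) z v
    extension pe bz rv with br7 ca cb cc cd ce cf cg pe bz rv
    ... | inj₁ (refl , refl) =
      _ , _ , brrb-path ca cb cc cd a≢d b≢c (fwd here) (fwd (there here)) (fwd (there (there here)))
    ... | inj₂ (inj₁ (refl , refl)) =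
      _ , _ , brrb-path cd cc cb ca (≢-sym a≢d) (≢-sym b≢c) (bwd (there (there here))) (bwd (there here)) (bwd here)
    ... | inj₂ (inj₂ (inj₁ (refl , refl))) =
      _ , _ , brrb-path cd ce cf cg d≢g e≢f (fwd (there (there (there here))))
                        (fwd (there (there (there (there here))))) (fwd (there (there (there (there (there here))))))
    ... | inj₂ (inj₂ (inj₂ (refl , refl))) =
      _ , _ , brrb-path cg cf ce cd (≢-sym d≢g) (≢-sym e≢f) (bwd (there (there (there (there (there here))))))
                        (bwd (there (there (there (there here))))) (bwd (there (there (there here))))

    -- Given a brrb-path d r s w of the old tree, a b c d starts a sequence of the new tree that
    -- adds g f e d r s w next.
    through-a : ∀ {r s w} → Brrb (Edge Ps) (d ∷ r ∷ s ∷ w ∷ []) → Rebuilt Ps (d ∷ r ∷ s ∷ w ∷ []) →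
                Rebuilt (Pt ∷ Ps) (a ∷ b ∷ c ∷ d ∷ [])
    through-a {r} {s} {w} (((_ ∷ _ ∷ d≢w ∷ []) ∷ (r≢s ∷ _) ∷ _) , d-r ∷ r-s ∷ s-w ∷ [-] , _ ∷ cr ∷ cs ∷ cw ∷ []) =
      reroute second splice6 (λ x∈Pt x-old → subst (_∈ d ∷ r ∷ s ∷ w ∷ []) (sym (only x∈Pt x-old)) (here refl))
      where
        r-old : Vert Ps r
        r-old = proj₂ (edge-ends d-r)
        s-old : Vert Ps s
        s-old = proj₂ (edge-ends r-s)
        w-old : Vert Ps w
        w-old = proj₂ (edge-ends s-w)
        a-new : ∀ {y} → Vert Ps y → a ≢ y
        a-new = fresh (here refl) a≢d
        b-new : ∀ {y} → Vert Ps y → b ≢ y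
        b-new = fresh (there (here refl)) (red≢black cb cd)
        c-new : ∀ {y} → Vert Ps y → c ≢ y
        c-new = fresh (there (there (here refl))) (red≢black cc cd)
        e-new : ∀ {y} → Vert Ps y → e ≢ y
        e-new = fresh (there (there (there (there (here refl))))) (red≢black ce cd)
        f-new : ∀ {y} → Vert Ps y → f ≢ y
        f-new = fresh (there (there (there (there (there (here refl)))))) (red≢black cf cd)
        g-new : ∀ {y} → Vert Ps y → g ≢ y
        g-new = fresh (there (there (there (there (there (there (here refl))))))) (≢-sym d≢g)

        second : Attached (_∈ a ∷ b ∷ c ∷ d ∷ []) (g ∷ f ∷ e ∷ d ∷ r ∷ s ∷ w ∷ [])
        second = attached d _ k6 (cg ∷ cf ∷ ce ∷ cd ∷ cr ∷ cs ∷ cw ∷ [])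
          ( (black≢red cg cf ∷ black≢red cg ce ∷ ≢-sym d≢g ∷ black≢red cg cr ∷ black≢red cg cs ∷ g-new w-old ∷ []) ∷
            (≢-sym e≢f ∷ red≢black cf cd ∷ f-new r-old ∷ f-new s-old ∷ red≢black cf cw ∷ []) ∷
            (red≢black ce cd ∷ e-new r-old ∷ e-new s-old ∷ red≢black ce cw ∷ []) ∷
            (black≢red cd cr ∷ black≢red cd cs ∷ d≢w ∷ []) ∷
            (r≢s ∷ red≢black cr cw ∷ []) ∷ (red≢black cs cw ∷ []) ∷ [] ∷ [] )
          (there (there (there (here refl))))
          (meet-at (g ∷ f ∷ e ∷ []) (r ∷ s ∷ w ∷ []) (a ∷ b ∷ c ∷ []) []
            ( (≢-sym a≢g ∷ black≢red cg cb ∷ black≢red cg cc ∷ []) ∷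
              (red≢black cf ca ∷ ≢-sym b≢f ∷ ≢-sym c≢f ∷ []) ∷
              (red≢black ce ca ∷ ≢-sym b≢e ∷ ≢-sym c≢e ∷ []) ∷
              (red≢black cr ca ∷ ≢-sym (b-new r-old) ∷ ≢-sym (c-new r-old) ∷ []) ∷
              (red≢black cs ca ∷ ≢-sym (b-new s-old) ∷ ≢-sym (c-new s-old) ∷ []) ∷
              (≢-sym (a-new w-old) ∷ black≢red cw cb ∷ black≢red cw cc ∷ []) ∷ [] ))

  black-neighbour : ∀ {Ps x} → Built Ps → Vert Ps x → Red x → Neighbour Black Ps x
  black-neighbour (base _ (c0 ∷ _ ∷ _ ∷ c3 ∷ [])) (here x∈Q) rx with x∈Q
  ... | here refl                         = ⊥-elim (clash c0 rx)
  ... | there (here refl)                 = _ , c0 , bwd here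
  ... | there (there (here refl))         = _ , c3 , fwd (there (there here))
  ... | there (there (there (here refl))) = ⊥-elim (clash c3 rx)
  black-neighbour (base _ _) (there ())
  black-neighbour (add bt _) (there x-old) rx =
    Product.map₂ (Product.map₂ there) (black-neighbour bt x-old rx)
  black-neighbour (add bt (attached _ _ k4 (ca ∷ _ ∷ _ ∷ _ ∷ ce ∷ []) _ jm _)) (here x∈P) rx with x∈P
  ... | here refl                                 = ⊥-elim (clash ca rx)
  ... | there (here refl)                         = _ , ca , bwd here
  ... | there (there (here refl))                 =
    Product.map₂ (Product.map₂ there) (black-neighbour bt jm rx)
  ... | there (there (there (here refl)))         = _ , ce , fwd (there (there (there here)))
  ... | there (there (there (there (here refl)))) = ⊥-elim (clash ce rx)
  black-neighbour (add _ (attached _ _ k6 (ca ∷ _ ∷ _ ∷ cd ∷ _ ∷ _ ∷ cg ∷ []) _ _ _)) (here x∈P) rx with x∈P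
  ... | here refl                                                 = ⊥-elim (clash ca rx)
  ... | there (here refl)                                         = _ , ca , bwd here
  ... | there (there (here refl))                                 = _ , cd , fwd (there (there here))
  ... | there (there (there (here refl)))                         = ⊥-elim (clash cd rx)
  ... | there (there (there (there (here refl))))                 = _ , cd , bwd (there (there (there here)))
  ... | there (there (there (there (there (here refl)))))         = _ , cg , fwd (there (there (there (there (there here)))))
  ... | there (there (there (there (there (there (here refl)))))) = ⊥-elim (clash cg rx)

  red-neighbour : ∀ {Ps x} → Built Ps → Vert Ps x → Black x → Neighbour Red Ps x
  red-neighbour (base _ (_ ∷ c1 ∷ c2 ∷ _ ∷ [])) (here x∈Q) bx with x∈Q
  ... | here refl                         = _ , c1 , fwd here
  ... | there (here refl)                 = ⊥-elim (clash bx c1)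
  ... | there (there (here refl))         = ⊥-elim (clash bx c2)
  ... | there (there (there (here refl))) = _ , c2 , bwd (there (there here))
  red-neighbour (base _ _) (there ())
  red-neighbour (add bt _) (there x-old) bx =
    Product.map₂ (Product.map₂ there) (red-neighbour bt x-old bx)
  red-neighbour (add _ (attached _ _ k4 (_ ∷ cb ∷ cc ∷ cd ∷ _ ∷ []) _ _ _)) (here x∈P) bx with x∈P
  ... | here refl                                 = _ , cb , fwd here
  ... | there (here refl)                         = ⊥-elim (clash bx cb)
  ... | there (there (here refl))                 = ⊥-elim (clash bx cc)
  ... | there (there (there (here refl)))         = ⊥-elim (clash bx cd)
  ... | there (there (there (there (here refl)))) = _ , cd , bwd (there (there (there here)))
  red-neighbour (add _ (attached _ _ k6 (_ ∷ cb ∷ cc ∷ _ ∷ ce ∷ cf ∷ _ ∷ []) _ _ _)) (here x∈P) bx with x∈P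
  ... | here refl                                                 = _ , cb , fwd here
  ... | there (here refl)                                         = ⊥-elim (clash bx cb)
  ... | there (there (here refl))                                 = ⊥-elim (clash bx cc)
  ... | there (there (there (here refl)))                         = _ , cc , bwd (there (there here))
  ... | there (there (there (there (here refl))))                 = ⊥-elim (clash bx ce)
  ... | there (there (there (there (there (here refl)))))         = ⊥-elim (clash bx cf)
  ... | there (there (there (there (there (there (here refl)))))) = _ , cf , bwd (there (there (there (there (there here)))))

  extend : ∀ {Ps z c} → Built Ps → Black z → Red c → Edge Ps z c → Extension Ps z c
  extend (base _ _) _ _ (there ())
  extend (base ((_ ∷ _ ∷ q0≢q3 ∷ []) ∷ (q1≢q2 ∷ _) ∷ _) (c0 ∷ c1 ∷ c2 ∷ c3 ∷ [])) bz rc (here pe)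
    with br4 c0 c1 c2 c3 pe bz rc
  ... | inj₁ (refl , refl) =
    _ , _ , brrb-path c0 c1 c2 c3 q0≢q3 q1≢q2 (fwd here) (fwd (there here)) (fwd (there (there here)))
  ... | inj₂ (refl , refl) =
    _ , _ , brrb-path c3 c2 c1 c0 (≢-sym q0≢q3) (≢-sym q1≢q2) (bwd (there (there here))) (bwd (there here)) (bwd here)
  extend (add bt _) bz rc (there e) =
    let r , w , U , l , col = extend bt bz rc e in r , w , U , Linked.map there l , col
  extend (add bt at@(attached _ _ k4 _ _ _ _)) bz rc (here pe) =
    Attach4.extension A (black-neighbour bt (Arm4.anchored A) (Arm4.cc A)) pe bz rc
    where A = arm4 at
  extend (add bt at@(attached _ _ k6 _ _ _ _)) bz rc (here pe) = Attach6.extension (arm6 at) pe bz rc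

  -- The brrb-paths of the base path Q are Q and its reverse.
  rebuilt-base : ∀ {Q} → Unique Q → Coloured Q brrb → Rerootable (Q ∷ [])
  rebuilt-base (_ ∷ (q1≢q2 ∷ _) ∷ _) (c0 ∷ c1 ∷ c2 ∷ c3 ∷ []) (_ , e01 ∷ e12 ∷ e23 ∷ [-] , b0 ∷ b1 ∷ b2 ∷ b3 ∷ [])
    with rr4 c0 c1 c2 c3 (in-base e12) b1 b2 | br4 c0 c1 c2 c3 (in-base e01) b0 b1
       | br4 c0 c1 c2 c3 (pathEdge-sym (in-base e23)) b3 b2
    where
      in-base : ∀ {P u v} → Edge (P ∷ []) u v → PathEdge P u v
      in-base (here pe) = pe
      in-base (there ())
  ... | inj₁ (refl , refl) | inj₁ (refl , _)   | inj₂ (refl , _)   = rebuilt-self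
  ... | inj₂ (refl , refl) | inj₂ (refl , _)   | inj₁ (refl , _)   = rebuilt-reverse rebuilt-self
  ... | inj₁ (refl , refl) | inj₂ (_ , q1≡q2) | _                 = ⊥-elim (q1≢q2 q1≡q2)
  ... | inj₁ (refl , refl) | _                 | inj₁ (_ , q2≡q1) = ⊥-elim (q1≢q2 (sym q2≡q1))
  ... | inj₂ (refl , refl) | inj₁ (_ , q2≡q1) | _                 = ⊥-elim (q1≢q2 (sym q2≡q1))
  ... | inj₂ (refl , refl) | _                 | inj₂ (_ , q1≡q2) = ⊥-elim (q1≢q2 q1≡q2)

  -- Entering the newest path at its first end: extend the old part of the path into a brrb-path O
  -- of the old tree and restart there by induction.
  from-end4 : ∀ {Ps a b c d e z} → Built Ps → Rerootable Ps → Arm4 Ps a b c d e → Black z → Edge Ps c z →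
              Rebuilt ((a ∷ b ∷ c ∷ d ∷ e ∷ []) ∷ Ps) (a ∷ b ∷ c ∷ z ∷ [])
  from-end4 bt ih A bz c-z =
    let _ , _ , O = extend bt bz (Arm4.cc A) (edge-sym c-z) in Attach4.through-a A O (ih O)

  from-end6 : ∀ {Ps a b c d e f g} → Built Ps → Rerootable Ps → Arm6 Ps a b c d e f g →
              Rebuilt ((a ∷ b ∷ c ∷ d ∷ e ∷ f ∷ g ∷ []) ∷ Ps) (a ∷ b ∷ c ∷ d ∷ [])
  from-end6 bt ih A =
    let r , cr , d-r = red-neighbour bt (Arm6.anchored A) (Arm6.cd A)
        _ , _ , O    = extend bt (Arm6.cd A) cr d-r
    in Attach6.through-a A O (ih O)

  -- The other end is the first end of the reversed path.
  enter4 : ∀ {Ps a b c d e} → Built Ps → Rerootable Ps → Arm4 Ps a b c d e →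
           ∀ {ys} → Entry4 Ps a b c d e ys → Rebuilt ((a ∷ b ∷ c ∷ d ∷ e ∷ []) ∷ Ps) ys
  enter4 bt ih A (via-ab bz c-z) = from-end4 bt ih A bz c-z
  enter4 bt ih A (via-ed bz c-z) = rebuilt-≋ (mirrored _) (from-end4 bt ih (mirror4 A) bz c-z)

  enter6 : ∀ {Ps a b c d e f g} → Built Ps → Rerootable Ps → Arm6 Ps a b c d e f g →
           ∀ {ys} → Entry6 a b c d e f g ys → Rebuilt ((a ∷ b ∷ c ∷ d ∷ e ∷ f ∷ g ∷ []) ∷ Ps) ys
  enter6 bt ih A via-abc = from-end6 bt ih A
  enter6 bt ih A via-gfe = rebuilt-≋ (mirrored _) (from-end6 bt ih (mirror6 A))

  follow : ∀ {Ps Pt ys} {Entry : List V → Set} → Attached (Vert Ps) Pt →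
           (∀ {xs} → Entry xs → Rebuilt (Pt ∷ Ps) xs) → Rerootable Ps → Route Ps Entry ys → Rebuilt (Pt ∷ Ps) ys
  follow at _     ih (old p)      = rebuilt-extend at (ih p)
  follow _  enter _  (entering x) = enter x
  follow _  enter _  (reversed x) = rebuilt-reverse (enter x)

  reroot : ∀ {Ps} → Built Ps → Rerootable Ps
  reroot (base U col) p = rebuilt-base U col p
  reroot (add bt at@(attached _ _ k4 _ _ _ _)) p =
    follow at (enter4 bt (reroot bt) (arm4 at)) (reroot bt) (Attach4.route (arm4 at) p)
  reroot (add bt at@(attached _ _ k6 _ _ _ _)) p =
    follow at (enter6 bt (reroot bt) (arm6 at)) (reroot bt) (Attach6.route (arm6 at) p)

  built-from : ∀ {T : Graph n} (B : BuildingSequence T λc) → Σ Paths λ Ps → Built Ps × Ps ≋ (first B ∷ rest B)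
  built-from B =
    built (rest B) (base (proj₁ (first-path B)) (coloured _ (first-colour B))) here
          (λ { (here x∈Q) → x∈Q ; (there ()) }) (additions B)

  restart : ∀ {T : Graph n} (B : BuildingSequence T λc) {P R} → IsPath T P → map λc P ≡ brrb →
            Valid P R → (P ∷ R) ≋ (first B ∷ rest B) → BuildingSequence T λc
  restart B {P} {R} P-path P-colour valid same = record
    { first           = P
    ; rest            = R
    ; first-path      = P-path
    ; first-colour    = P-colour
    ; additions       = valid
    ; covers-vertices = λ v → ∈-concat⁺ (vert (proj₂ same) (∈-concat⁻ (first B ∷ rest B) (covers-vertices B v)))
    ; same-edges      = λ u v → mk⇔
        (λ uv → find (edge (proj₂ same) (∃∈-Any (Equivalence.to (same-edges B u v) uv))))
        (λ uv → Equivalence.from (same-edges B u v) (find (edge (proj₁ same) (∃∈-Any uv))))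
    }

  rebuild : ∀ {T : Graph n} → BuildingSequence T λc → ∀ {P} → IsPath T P → map λc P ≡ brrb →
            Σ (BuildingSequence T λc) λ B → first B ≡ P
  rebuild {T} B {P} P-path@(P-unique , P-linked) P-colour =
    let Ps , tree , tree≋B = built-from B
        adj⇒edge : ∀ {u v} → Adj T u v → Edge Ps u v
        adj⇒edge {u} {v} uv = edge (proj₂ tree≋B) (∃∈-Any (Equivalence.to (same-edges B u v) uv))
        R , valid , P∷R≋tree = reroot tree (P-unique , Linked.map adj⇒edge P-linked , coloured P P-colour)
    in restart B P-path P-colour valid (≋-trans P∷R≋tree tree≋B) , refl

proposition2 : ∀ {n : ℕ} (T : Graph n) (λc : Fin n → Colour) →
    IsSkeleton T λc →
    ∀ (P : List (Fin n)) → IsBrrbPath T λc P →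
    Σ (BuildingSequence T λc) λ B → (first B ≡ P) ⊎ (first B ≡ reverse P)
proposition2 T λc B P (P-path , P-colour) = Product.map₂ inj₁ (Rerooting.rebuild λc B P-path P-colour)
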